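{- Let $k\ge 2$. Then $R_n^{(k,\emptyset,0,0)}(x)=n!$ for $1\le n\le k$, for every $n>k$ \[ R_n^{(k,\emptyset,0,0)}(x)=k!\,(x+k)(x+k+1)\cdots(x+n-1), \] and \[ P^{(k,\emptyset,0,0)}(t,x):=\sum_{n\ge k}R_n^{(k,\emptyset,0,0)}(x)\frac{t^{n-k}}{(n-k)!}=k!\,(1-t)^{ -(x+k)}. \]
   Context: For $\sigma=\sigma_1\cdots\sigma_n\in S_n$ and an index $i$: quadrant I relative to $(i,\sigma_i)$ consists of the points $(j,\sigma_j)$ with $j>i,\sigma_j>\sigma_i$, and quadrant II of those with $j<i,\sigma_j>\sigma_i$. $\sigma_i$ matches $MMP(k,\emptyset,0,0)$ if quadrant I contains at least $k$ points and quadrant II contains no point. $mmp^{(k,\emptyset,0,0)}(\sigma)$ is the number of such $i$, and $R_n^{(k,\emptyset,0,0)}(x)=\sum_{\sigma\in S_n}x^{mmp^{(k,\emptyset,0,0)}(\sigma)}$. -}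

module Defs where

open import Data.Bool using (Bool; true; false; _∧_; not; if_then_else_)
open import Data.Nat using (ℕ; zero; suc; _+_; _*_; _^_; _<ᵇ_; _≡ᵇ_; _≤ᵇ_)
open import Data.Fin using (Fin; toℕ)
open import Data.List using (List; []; _∷_; map; concatMap; allFin)
open import Data.Nat.ListAction using (sum)
open import Data.Bool.ListAction using (and)
open import Data.Vec using (Vec; []; _∷_; lookup)

countᵇ : {A : Set} → (A → Bool) → List A → ℕ
countᵇ p []       = 0
countᵇ p (a ∷ as) = (if p a then 1 else 0) + countᵇ p as

filterᵇ : {A : Set} → (A → Bool) → List A → List A
filterᵇ p []       = []
filterᵇ p (a ∷ as) = if p a then a ∷ filterᵇ p as else filterᵇ p as

allWords : (len m : ℕ) → List (Vec (Fin m) len)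
allWords zero    m = [] ∷ []
allWords (suc l) m = concatMap (λ a → map (a ∷_) (allWords l m)) (allFin m)

isPerm : {n : ℕ} → Vec (Fin n) n → Bool
isPerm {n} σ =
  and (map (λ i → and (map (λ j → if toℕ i <ᵇ toℕ j
                                    then not (toℕ (lookup σ i) ≡ᵇ toℕ (lookup σ j))
                                    else true)
                           (allFin n)))
           (allFin n))

-- S_n in one-line notation: the list of all permutations of {1..n}
-- (encoded with values in Fin n, i.e. 0..n-1; order is all that matters).
perms : (n : ℕ) → List (Vec (Fin n) n)
perms n = filterᵇ isPerm (allWords n n)

quadI : {n : ℕ} → Vec (Fin n) n → Fin n → ℕ
quadI {n} σ i =
  countᵇ (λ j → (toℕ i <ᵇ toℕ j) ∧ (toℕ (lookup σ i) <ᵇ toℕ (lookup σ j))) (allFin n)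

quadII : {n : ℕ} → Vec (Fin n) n → Fin n → ℕ
quadII {n} σ i =
  countᵇ (λ j → (toℕ j <ᵇ toℕ i) ∧ (toℕ (lookup σ i) <ᵇ toℕ (lookup σ j))) (allFin n)

-- σᵢ matches MMP(k,∅,0,0): quadrant I has ≥ k points and quadrant II is empty.
matchesMMP : (k : ℕ) {n : ℕ} → Vec (Fin n) n → Fin n → Bool
matchesMMP k σ i = (k ≤ᵇ quadI σ i) ∧ (quadII σ i ≡ᵇ 0)

mmp : (k : ℕ) {n : ℕ} → Vec (Fin n) n → ℕ
mmp k {n} σ = countᵇ (matchesMMP k σ) (allFin n)

R : (k n x : ℕ) → ℕ
R k n x = sum (map (λ σ → x ^ mmp k σ) (perms n))

-- Every permutation of {0..n} arises uniquely by inserting the new minimum 0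
-- at some position p into a permutation of {1..n}.  Since 0 lies below every
-- other point, the insertion does not change any quadrant count of the old
-- points; and the new point itself has all other points above it, so its
-- quadrant II is empty only for p = 0, in which case its quadrant I holds all
-- n remaining points.  Hence
--   R(n+1) = x^[k ≤ n] R(n) + n R(n),
-- which gives n! for n ≤ k and k! (x+k)(x+k+1)⋯(x+n-1) beyond, and the last
-- product is m! C(x+k+m-1, m) for m = n - k.
module Submission where

open import Defs
open import Data.Bool using (Bool; true; false; _∧_; not; if_then_else_; T)
open import Data.Bool.ListAction using (all)
open import Data.Bool.Properties using (∧-zeroʳ; ∧-identityʳ; T?; T-≡)
open import Data.Fin as Fin using (Fin; zero; suc; toℕ; punchIn; punchOut)
import Data.Fin.Properties as Finₚ
open import Data.List as List
  using (List; []; _∷_; _∷ʳ_; map; allFin; tabulate; applyUpTo; cartesianProductWith)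
import Data.List.Properties as Listₚ
open import Data.List.Membership.Propositional using (_∈_)
import Data.List.Membership.Propositional.Properties as ∈ₚ
open import Data.List.Membership.Propositional.Properties.WithK using (unique∧set⇒bag)
open import Data.List.Relation.Binary.BagAndSetEquality using (∼bag⇒↭)
open import Data.List.Relation.Binary.Permutation.Propositional using (_↭_)
import Data.List.Relation.Binary.Permutation.Propositional.Properties as ↭ₚ
open import Data.List.Relation.Unary.All.Properties using (all⁺; all⁻; tabulate⁺; tabulate⁻)
open import Data.List.Relation.Unary.Any using (here)
import Data.List.Relation.Unary.AllPairs as AllPairs
import Data.List.Relation.Unary.All as All
open import Data.List.Relation.Unary.Unique.Propositional using (Unique)
import Data.List.Relation.Unary.Unique.Propositional.Properties as Uniqueₚ
open import Data.Nat using (ℕ; zero; suc; z≤n; s≤s; _+_; _*_; _^_; _∸_; _≤_; _<_; _!; _<ᵇ_; _≡ᵇ_; _≤ᵇ_)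
open import Data.Nat.Combinatorics using (_C_; nCk≡n!/k![n-k]!; k![n∸k]!∣n!)
open import Data.Nat.DivMod using (_/_; m*[n/m]≡n)
open import Data.Nat.ListAction using (sum; product)
import Data.Nat.ListAction.Properties as ListActionₚ
import Data.Nat.Properties as ℕₚ
open import Data.Nat.Properties using (_!≢0; _!*_!≢0)
import Algebra.Properties.CommutativeSemigroup ℕₚ.+-commutativeSemigroup as +-Semigroupₚ
import Algebra.Properties.CommutativeSemigroup ℕₚ.*-commutativeSemigroup as *-Semigroupₚ
open import Data.Nat.Solver using (module +-*-Solver)
open import Data.Product using (_×_; _,_; proj₁; proj₂; ∃-syntax)
open import Data.Sum using (_⊎_; inj₁; inj₂)
open import Data.Vec as Vec using (Vec; []; _∷_; lookup; insertAt)
import Data.Vec.Properties as Vecₚ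
open import Function using (_∘_; _⇔_)
open import Function.Bundles using (mk⇔; Equivalence)
open import Function.Definitions using (Injective)
open import Relation.Binary.Definitions using (tri<; tri≈; tri>)
open import Relation.Binary.PropositionalEquality
open import Relation.Nullary using (¬_; yes; no; contradiction)

private
  variable
    A B D : Set
    n : ℕ

fromBool : Bool → ℕ
fromBool b = if b then 1 else 0

countFin : (Fin n → Bool) → ℕ
countFin {n} p = countᵇ p (allFin n)

countᵇ-tabulate : (p : A → Bool) (f : Fin n → A) →
                  countᵇ p (tabulate f) ≡ countFin (p ∘ f)
countᵇ-tabulate {n = zero}  p f = refl
countᵇ-tabulate {n = suc n} p f =
  cong (fromBool (p (f zero)) +_) (trans (countᵇ-tabulate p (f ∘ suc)) (sym (countᵇ-tabulate (p ∘ f) suc)))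

countFin-suc : (p : Fin (suc n) → Bool) → countFin p ≡ fromBool (p zero) + countFin (p ∘ suc)
countFin-suc p = cong (fromBool (p zero) +_) (countᵇ-tabulate p suc)

countFin-cong : {p q : Fin n → Bool} → (∀ i → p i ≡ q i) → countFin p ≡ countFin q
countFin-cong {zero}  eq = refl
countFin-cong {suc n} {p} {q} eq = begin
  countFin p                            ≡⟨ countFin-suc p ⟩
  fromBool (p zero) + countFin (p ∘ suc) ≡⟨ cong₂ _+_ (cong fromBool (eq zero)) (countFin-cong (eq ∘ suc)) ⟩
  fromBool (q zero) + countFin (q ∘ suc) ≡⟨ countFin-suc q ⟨
  countFin q                            ∎
  where open ≡-Reasoning

countFin-false : {p : Fin n → Bool} → (∀ i → p i ≡ false) → countFin p ≡ 0
countFin-false {zero}  eq = refl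
countFin-false {suc n} {p} eq =
  trans (countFin-suc p) (cong₂ (λ b c → fromBool b + c) (eq zero) (countFin-false (eq ∘ suc)))

countFin-true : {p : Fin n → Bool} → (∀ i → p i ≡ true) → countFin p ≡ n
countFin-true {zero}  eq = refl
countFin-true {suc n} {p} eq =
  trans (countFin-suc p) (cong₂ (λ b c → fromBool b + c) (eq zero) (countFin-true (eq ∘ suc)))

countFin-punchIn : (i : Fin (suc n)) (p : Fin (suc n) → Bool) →
                   countFin p ≡ fromBool (p i) + countFin (p ∘ punchIn i)
countFin-punchIn zero p = countFin-suc p
countFin-punchIn {suc n} (suc i) p = begin
  countFin p
    ≡⟨ countFin-suc p ⟩
  a + countFin (p ∘ suc)
    ≡⟨ cong (a +_) (countFin-punchIn i (p ∘ suc)) ⟩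
  a + (b + countFin (p ∘ suc ∘ punchIn i))
    ≡⟨ +-Semigroupₚ.x∙yz≈y∙xz a b _ ⟩
  b + (a + countFin (p ∘ suc ∘ punchIn i))
    ≡⟨ cong (b +_) (countFin-suc (p ∘ punchIn (suc i))) ⟨
  b + countFin (p ∘ punchIn (suc i))
    ∎
  where
  open ≡-Reasoning
  a = fromBool (p zero)
  b = fromBool (p (suc i))

T-if-not : ∀ b c → T (if b then not c else true) ⇔ (T b → ¬ T c)
T-if-not false c = mk⇔ (λ _ ()) (λ _ → _)
T-if-not true false = mk⇔ (λ _ _ ()) (λ _ → _)
T-if-not true true = mk⇔ (λ ()) (λ f → f _ _)

distinctIfBefore : Vec (Fin n) n → Fin n → Fin n → Bool
distinctIfBefore σ i j =
  if toℕ i <ᵇ toℕ j then not (toℕ (lookup σ i) ≡ᵇ toℕ (lookup σ j)) else true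

T-isPerm : (σ : Vec (Fin n) n) → T (isPerm σ) ⇔ (∀ i j → T (distinctIfBefore σ i j))
T-isPerm {n} σ = mk⇔
  (λ h i → tabulate⁻ (all⁺ (distinctIfBefore σ i) _ (tabulate⁻ (all⁺ row _ h) i)))
  (λ h → all⁻ row (tabulate⁺ λ i → all⁻ (distinctIfBefore σ i) (tabulate⁺ (h i))))
  where
  row : Fin n → Bool
  row i = all (distinctIfBefore σ i) (allFin n)

isPerm⇒distinct : (σ : Vec (Fin n) n) → T (isPerm σ) →
                  ∀ {i j} → i Fin.< j → lookup σ i ≢ lookup σ j
isPerm⇒distinct σ h {i} {j} i<j σi≡σj =
  Equivalence.to (T-if-not _ _) (Equivalence.to (T-isPerm σ) h i j)
    (ℕₚ.<⇒<ᵇ i<j) (ℕₚ.≡⇒≡ᵇ _ _ (cong toℕ σi≡σj))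

isPerm⇒injective : (σ : Vec (Fin n) n) → T (isPerm σ) → Injective _≡_ _≡_ (lookup σ)
isPerm⇒injective σ h {i} {j} σi≡σj with Finₚ.<-cmp i j
... | tri< i<j _ _ = contradiction σi≡σj (isPerm⇒distinct σ h i<j)
... | tri≈ _ i≡j _ = i≡j
... | tri> _ _ j<i = contradiction (sym σi≡σj) (isPerm⇒distinct σ h j<i)

injective⇒isPerm : (σ : Vec (Fin n) n) → Injective _≡_ _≡_ (lookup σ) → T (isPerm σ)
injective⇒isPerm σ inj = Equivalence.from (T-isPerm σ) λ i j →
  Equivalence.from (T-if-not _ _) λ i<ᵇj σi≡ᵇσj →
    ℕₚ.<-irrefl (cong toℕ (inj (Finₚ.toℕ-injective (ℕₚ.≡ᵇ⇒≡ _ _ σi≡ᵇσj)))) (ℕₚ.<ᵇ⇒< _ _ i<ᵇj)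

concatMap-map≡cartesianProductWith : (f : A → B → D) (xs : List A) (ys : List B) →
  List.concatMap (λ x → map (f x) ys) xs ≡ cartesianProductWith f xs ys
concatMap-map≡cartesianProductWith f []       ys = refl
concatMap-map≡cartesianProductWith f (x ∷ xs) ys =
  cong (map (f x) ys List.++_) (concatMap-map≡cartesianProductWith f xs ys)

allWords-suc : ∀ l m → allWords (suc l) m ≡ cartesianProductWith _∷_ (allFin m) (allWords l m)
allWords-suc l m = concatMap-map≡cartesianProductWith _∷_ (allFin m) (allWords l m)

allWords-unique : ∀ l m → Unique (allWords l m)
allWords-unique zero    m = All.[] AllPairs.∷ AllPairs.[]
allWords-unique (suc l) m rewrite allWords-suc l m =
  Uniqueₚ.cartesianProductWith⁺ _∷_ Vecₚ.∷-injective (Uniqueₚ.allFin⁺ m) (allWords-unique l m)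

∈-allWords : ∀ {l m} (w : Vec (Fin m) l) → w ∈ allWords l m
∈-allWords []                  = here refl
∈-allWords {suc l} {m} (a ∷ w) rewrite allWords-suc l m =
  ∈ₚ.∈-cartesianProductWith⁺ _∷_ (∈ₚ.∈-allFin a) (∈-allWords w)

filterᵇ≡filter : (p : A → Bool) (xs : List A) → filterᵇ p xs ≡ List.filter (T? ∘ p) xs
filterᵇ≡filter p []       = refl
filterᵇ≡filter p (x ∷ xs) with p x
... | true  = cong (x ∷_) (filterᵇ≡filter p xs)
... | false = filterᵇ≡filter p xs

perms-unique : ∀ n → Unique (perms n)
perms-unique n rewrite filterᵇ≡filter isPerm (allWords n n) =
  Uniqueₚ.filter⁺ (T? ∘ isPerm) (allWords-unique n n)

∈-perms⁻ : (σ : Vec (Fin n) n) → σ ∈ perms n → Injective _≡_ _≡_ (lookup σ)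
∈-perms⁻ {n} σ σ∈ rewrite filterᵇ≡filter isPerm (allWords n n) =
  isPerm⇒injective σ (proj₂ (∈ₚ.∈-filter⁻ (T? ∘ isPerm) {xs = allWords n n} σ∈))

∈-perms⁺ : (σ : Vec (Fin n) n) → Injective _≡_ _≡_ (lookup σ) → σ ∈ perms n
∈-perms⁺ {n} σ inj rewrite filterᵇ≡filter isPerm (allWords n n) =
  ∈ₚ.∈-filter⁺ (T? ∘ isPerm) (∈-allWords σ) (injective⇒isPerm σ inj)

insertMin : Fin (suc n) → Vec (Fin n) n → Vec (Fin (suc n)) (suc n)
insertMin p σ = insertAt (Vec.map suc σ) p zero

lookup-insertMin-pivot : (p : Fin (suc n)) (σ : Vec (Fin n) n) → lookup (insertMin p σ) p ≡ zero
lookup-insertMin-pivot p σ = Vecₚ.insertAt-lookup (Vec.map suc σ) p zero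

lookup-insertMin-punchIn : (p : Fin (suc n)) (σ : Vec (Fin n) n) (j : Fin n) →
                           lookup (insertMin p σ) (punchIn p j) ≡ suc (lookup σ j)
lookup-insertMin-punchIn p σ j =
  trans (Vecₚ.insertAt-punchIn (Vec.map suc σ) p zero j) (Vecₚ.lookup-map j suc σ)

pivot-or-punchIn : (p a : Fin (suc n)) → a ≡ p ⊎ ∃[ j ] a ≡ punchIn p j
pivot-or-punchIn p a with p Finₚ.≟ a
... | yes p≡a = inj₁ (sym p≡a)
... | no  p≢a = inj₂ (punchOut p≢a , sym (Finₚ.punchIn-punchOut p≢a))

lookup-extensionality : {u v : Vec A n} → (∀ i → lookup u i ≡ lookup v i) → u ≡ v
lookup-extensionality {u = u} {v} eq =
  trans (sym (Vecₚ.tabulate∘lookup u)) (trans (Vecₚ.tabulate-cong eq) (Vecₚ.tabulate∘lookup v))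

insertMin-injective : {p q : Fin (suc n)} {σ τ : Vec (Fin n) n} →
                      insertMin p σ ≡ insertMin q τ → p ≡ q × σ ≡ τ
insertMin-injective {p = p} {q} {σ} {τ} eq with pivot-or-punchIn q p
... | inj₂ (j , refl) = contradiction
  (trans (sym (lookup-insertMin-pivot p σ)) (trans (cong (λ v → lookup v p) eq) (lookup-insertMin-punchIn q τ j)))
  λ ()
... | inj₁ refl = refl , lookup-extensionality λ j → Finₚ.suc-injective
  (trans (sym (lookup-insertMin-punchIn p σ j))
  (trans (cong (λ v → lookup v (punchIn p j)) eq) (lookup-insertMin-punchIn p τ j)))

insertMin-preserves-injective : (p : Fin (suc n)) (σ : Vec (Fin n) n) →
  Injective _≡_ _≡_ (lookup σ) → Injective _≡_ _≡_ (lookup (insertMin p σ))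
insertMin-preserves-injective p σ inj {a} {b} eq with pivot-or-punchIn p a | pivot-or-punchIn p b
... | inj₁ refl | inj₁ refl = refl
... | inj₁ refl | inj₂ (j , refl) = contradiction
  (trans (sym (lookup-insertMin-pivot p σ)) (trans eq (lookup-insertMin-punchIn p σ j))) λ ()
... | inj₂ (i , refl) | inj₁ refl = contradiction
  (trans (sym (lookup-insertMin-pivot p σ)) (trans (sym eq) (lookup-insertMin-punchIn p σ i))) λ ()
... | inj₂ (i , refl) | inj₂ (j , refl) = cong (punchIn p) (inj (Finₚ.suc-injective
  (trans (sym (lookup-insertMin-punchIn p σ i)) (trans eq (lookup-insertMin-punchIn p σ j)))))

injective⇒zero-in-image : (f : Fin (suc n) → Fin (suc n)) → Injective _≡_ _≡_ f → ∃[ p ] f p ≡ zero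
-- If zero were missed, punching it out would inject Fin (suc n) into Fin n.
injective⇒zero-in-image {n} f inj with Finₚ.any? (λ i → f i Finₚ.≟ zero)
... | yes hit = hit
... | no  miss = contradiction (Finₚ.injective⇒≤ squeeze-injective) ℕₚ.1+n≰n
  where
  avoid : ∀ i → zero ≢ f i
  avoid i eq = miss (i , sym eq)
  squeeze : Fin (suc n) → Fin n
  squeeze i = punchOut (avoid i)
  squeeze-injective : Injective _≡_ _≡_ squeeze
  squeeze-injective eq = inj (Finₚ.punchOut-injective (avoid _) (avoid _) eq)

injective⇒insertMin : (x : Vec (Fin (suc n)) (suc n)) → Injective _≡_ _≡_ (lookup x) →
  ∃[ p ] ∃[ σ ] Injective _≡_ _≡_ (lookup σ) × insertMin p σ ≡ x
injective⇒insertMin {n} x inj = p , σ , σ-injective , lookup-extensionality agree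
  where
  p = proj₁ (injective⇒zero-in-image (lookup x) inj)
  xp≡0 = proj₂ (injective⇒zero-in-image (lookup x) inj)
  nonzero : (j : Fin n) → zero ≢ lookup x (punchIn p j)
  nonzero j eq = Finₚ.punchInᵢ≢i p j (inj (trans (sym eq) (sym xp≡0)))
  σ : Vec (Fin n) n
  σ = Vec.tabulate λ j → punchOut (nonzero j)
  lookup-σ : ∀ j → lookup σ j ≡ punchOut (nonzero j)
  lookup-σ = Vecₚ.lookup∘tabulate _
  σ-injective : Injective _≡_ _≡_ (lookup σ)
  σ-injective {i} {j} eq = Finₚ.punchIn-injective p i j (inj
    (Finₚ.punchOut-injective (nonzero i) (nonzero j) (trans (sym (lookup-σ i)) (trans eq (lookup-σ j)))))
  agree : ∀ a → lookup (insertMin p σ) a ≡ lookup x a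
  agree a with pivot-or-punchIn p a
  ... | inj₁ refl = trans (lookup-insertMin-pivot p σ) (sym xp≡0)
  ... | inj₂ (j , refl) = trans (lookup-insertMin-punchIn p σ j)
    (trans (cong suc (lookup-σ j)) (Finₚ.punchIn-punchOut (nonzero j)))

perms-suc-↭ : ∀ n → perms (suc n) ↭ cartesianProductWith insertMin (allFin (suc n)) (perms n)
perms-suc-↭ n = ∼bag⇒↭ (unique∧set⇒bag (perms-unique (suc n)) insertions-unique (mk⇔ to from))
  where
  insertions-unique : Unique (cartesianProductWith insertMin (allFin (suc n)) (perms n))
  insertions-unique = Uniqueₚ.cartesianProductWith⁺ insertMin insertMin-injective
    (Uniqueₚ.allFin⁺ (suc n)) (perms-unique n)
  to : ∀ {x} → x ∈ perms (suc n) → x ∈ cartesianProductWith insertMin (allFin (suc n)) (perms n)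
  to {x} x∈ with injective⇒insertMin x (∈-perms⁻ x x∈)
  ... | p , σ , σ-injective , refl =
    ∈ₚ.∈-cartesianProductWith⁺ insertMin (∈ₚ.∈-allFin p) (∈-perms⁺ σ σ-injective)
  from : ∀ {x} → x ∈ cartesianProductWith insertMin (allFin (suc n)) (perms n) → x ∈ perms (suc n)
  from x∈ with ∈ₚ.∈-cartesianProductWith⁻ insertMin (allFin (suc n)) (perms n) x∈
  ... | p , σ , _ , σ∈ , refl =
    ∈-perms⁺ (insertMin p σ) (insertMin-preserves-injective p σ (∈-perms⁻ σ σ∈))

sum-map-cartesianProductWith : (f : D → ℕ) (g : A → B → D) (xs : List A) (ys : List B) →
  sum (map f (cartesianProductWith g xs ys)) ≡ sum (map (λ a → sum (map (f ∘ g a) ys)) xs)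
sum-map-cartesianProductWith f g []       ys = refl
sum-map-cartesianProductWith f g (x ∷ xs) ys = begin
  sum (map f (map (g x) ys List.++ cartesianProductWith g xs ys))
    ≡⟨ cong sum (Listₚ.map-++ f (map (g x) ys) _) ⟩
  sum (map f (map (g x) ys) List.++ map f (cartesianProductWith g xs ys))
    ≡⟨ ListActionₚ.sum-++ (map f (map (g x) ys)) _ ⟩
  sum (map f (map (g x) ys)) + sum (map f (cartesianProductWith g xs ys))
    ≡⟨ cong₂ _+_ (cong sum (sym (Listₚ.map-∘ ys))) (sum-map-cartesianProductWith f g xs ys) ⟩
  sum (map (f ∘ g x) ys) + sum (map (λ a → sum (map (f ∘ g a) ys)) xs)
    ∎
  where open ≡-Reasoning

sum-perms-suc : (f : Vec (Fin (suc n)) (suc n) → ℕ) →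
  sum (map f (perms (suc n))) ≡ sum (map (λ p → sum (map (f ∘ insertMin p) (perms n))) (allFin (suc n)))
sum-perms-suc {n} f = trans (ListActionₚ.sum-↭ (↭ₚ.map⁺ f (perms-suc-↭ n)))
  (sum-map-cartesianProductWith f insertMin (allFin (suc n)) (perms n))

punchIn-<ᵇ : (p : Fin (suc n)) (i j : Fin n) →
             (toℕ (punchIn p i) <ᵇ toℕ (punchIn p j)) ≡ (toℕ i <ᵇ toℕ j)
punchIn-<ᵇ zero    i       j       = refl
punchIn-<ᵇ (suc p) zero    zero    = refl
punchIn-<ᵇ (suc p) zero    (suc j) = refl
punchIn-<ᵇ (suc p) (suc i) zero    = refl
punchIn-<ᵇ (suc p) (suc i) (suc j) = punchIn-<ᵇ p i j

Side : Set
Side = ∀ {m} → Fin m → Fin m → Bool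

after before : Side
after  i j = toℕ i <ᵇ toℕ j
before i j = toℕ j <ᵇ toℕ i

above : Side → Vec (Fin n) n → Fin n → Fin n → Bool
above side σ i j = side i j ∧ (toℕ (lookup σ i) <ᵇ toℕ (lookup σ j))

countAbove-insertMin : (side : Side) →
  (∀ {m} (p : Fin (suc m)) i j → side (punchIn p i) (punchIn p j) ≡ side i j) →
  (p : Fin (suc n)) (σ : Vec (Fin n) n) (i : Fin n) →
  countFin (above side (insertMin p σ) (punchIn p i)) ≡ countFin (above side σ i)
countAbove-insertMin side side-punchIn p σ i =
  trans (countFin-punchIn p _) (cong₂ _+_ (cong fromBool pivot-not-above) (countFin-cong shifted))
  where
  pivot-not-above : above side (insertMin p σ) (punchIn p i) p ≡ false
  pivot-not-above rewrite lookup-insertMin-pivot p σ = ∧-zeroʳ _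
  shifted : ∀ j → above side (insertMin p σ) (punchIn p i) (punchIn p j) ≡ above side σ i j
  shifted j rewrite lookup-insertMin-punchIn p σ i | lookup-insertMin-punchIn p σ j
                  | side-punchIn p i j = refl

matchesMMP-insertMin-punchIn : (k : ℕ) (p : Fin (suc n)) (σ : Vec (Fin n) n) (i : Fin n) →
  matchesMMP k (insertMin p σ) (punchIn p i) ≡ matchesMMP k σ i
matchesMMP-insertMin-punchIn k p σ i
  rewrite countAbove-insertMin after (λ p i j → punchIn-<ᵇ p i j) p σ i
        | countAbove-insertMin before (λ p i j → punchIn-<ᵇ p j i) p σ i = refl

minMatches : (k : ℕ) → Fin (suc n) → Bool
minMatches {n} k zero    = k ≤ᵇ n
minMatches     k (suc _) = false

quadI-insertMin-first : (σ : Vec (Fin n) n) → quadI (insertMin zero σ) zero ≡ n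
quadI-insertMin-first σ =
  trans (countFin-suc (above after (insertMin zero σ) zero)) (countFin-true values-positive)
  where
  values-positive : ∀ j → (0 <ᵇ toℕ (lookup (Vec.map suc σ) j)) ≡ true
  values-positive j = cong (λ v → 0 <ᵇ toℕ v) (Vecₚ.lookup-map j suc σ)

quadII-insertMin-first : (σ : Vec (Fin n) n) → quadII (insertMin zero σ) zero ≡ 0
quadII-insertMin-first σ = countFin-false {p = above before (insertMin zero σ) zero} λ _ → refl

-- Position 0 precedes the pivot and carries a value above the new minimum.
quadII-insertMin-later : (p : Fin (suc n)) (σ : Vec (Fin (suc n)) (suc n)) →
                         0 < quadII (insertMin (suc p) σ) (suc p)
quadII-insertMin-later p σ@(s ∷ _)
  rewrite countFin-suc (above before (insertMin (suc p) σ) (suc p))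
        | lookup-insertMin-pivot (suc p) σ = s≤s z≤n

matchesMMP-insertMin-pivot : (k : ℕ) (p : Fin (suc n)) (σ : Vec (Fin n) n) →
                             matchesMMP k (insertMin p σ) p ≡ minMatches k p
matchesMMP-insertMin-pivot k zero σ
  rewrite quadI-insertMin-first σ | quadII-insertMin-first σ = ∧-identityʳ _
matchesMMP-insertMin-pivot {suc n} k (suc p) σ
  with quadII (insertMin (suc p) σ) (suc p) | quadII-insertMin-later p σ
... | suc _ | _ = ∧-zeroʳ _

mmp-insertMin : (k : ℕ) (p : Fin (suc n)) (σ : Vec (Fin n) n) →
                mmp k (insertMin p σ) ≡ fromBool (minMatches k p) + mmp k σ
mmp-insertMin k p σ = trans (countFin-punchIn p (matchesMMP k (insertMin p σ)))
  (cong₂ _+_ (cong fromBool (matchesMMP-insertMin-pivot k p σ))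
             (countFin-cong (matchesMMP-insertMin-punchIn k p σ)))

sum-map-*ˡ : (c : ℕ) (f : A → ℕ) (xs : List A) → sum (map (λ a → c * f a) xs) ≡ c * sum (map f xs)
sum-map-*ˡ c f []       = sym (ℕₚ.*-zeroʳ c)
sum-map-*ˡ c f (x ∷ xs) = trans (cong (c * f x +_) (sum-map-*ˡ c f xs)) (sym (ℕₚ.*-distribˡ-+ c (f x) _))

sum-tabulate-const : (f : A → ℕ) (g : Fin n → A) {c : ℕ} → (∀ i → f (g i) ≡ c) →
                     sum (map f (tabulate g)) ≡ n * c
sum-tabulate-const {n = zero}  f g eq = refl
sum-tabulate-const {n = suc n} f g eq = cong₂ _+_ (eq zero) (sum-tabulate-const f (g ∘ suc) (eq ∘ suc))

R-suc : (k n x : ℕ) → R k (suc n) x ≡ x ^ fromBool (k ≤ᵇ n) * R k n x + n * R k n x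
R-suc k n x = begin
  R k (suc n) x
    ≡⟨ sum-perms-suc weight ⟩
  sum (map (weight ∘ insertMin zero) (perms n)) + sum (map later (tabulate suc))
    ≡⟨ cong₂ _+_ first-position (sum-tabulate-const later suc λ _ → later-position) ⟩
  x ^ fromBool (k ≤ᵇ n) * R k n x + n * R k n x
    ∎
  where
  open ≡-Reasoning
  weight : Vec (Fin (suc n)) (suc n) → ℕ
  weight σ = x ^ mmp k σ
  later : Fin (suc n) → ℕ
  later p = sum (map (weight ∘ insertMin p) (perms n))
  first-position : sum (map (weight ∘ insertMin zero) (perms n)) ≡ x ^ fromBool (k ≤ᵇ n) * R k n x
  first-position = trans
    (cong sum (Listₚ.map-cong (λ σ → trans (cong (x ^_) (mmp-insertMin k zero σ))
                                             (ℕₚ.^-distribˡ-+-* x (fromBool (k ≤ᵇ n)) (mmp k σ))) (perms n)))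
    (sum-map-*ˡ (x ^ fromBool (k ≤ᵇ n)) (λ σ → x ^ mmp k σ) (perms n))
  later-position : ∀ {p} → sum (map (weight ∘ insertMin (suc p)) (perms n)) ≡ R k n x
  later-position {p} = cong sum (Listₚ.map-cong (λ σ → cong (x ^_) (mmp-insertMin k (suc p) σ)) (perms n))

≤ᵇ-false : ∀ {k n} → n < k → (k ≤ᵇ n) ≡ false
≤ᵇ-false {k} {n} n<k with k ≤ᵇ n in eq
... | false = refl
... | true  = contradiction (ℕₚ.≤ᵇ⇒≤ k n (subst T (sym eq) _)) (ℕₚ.<⇒≱ n<k)

≤ᵇ-true : ∀ {k n} → k ≤ n → (k ≤ᵇ n) ≡ true
≤ᵇ-true k≤n = Equivalence.to T-≡ (ℕₚ.≤⇒≤ᵇ k≤n)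

R-≤ : (k x n : ℕ) → n ≤ k → R k n x ≡ n !
R-≤ k x zero    _   = refl
R-≤ k x (suc n) n<k = begin
  R k (suc n) x                                 ≡⟨ R-suc k n x ⟩
  x ^ fromBool (k ≤ᵇ n) * R k n x + n * R k n x ≡⟨ cong (λ b → x ^ fromBool b * R k n x + n * R k n x) (≤ᵇ-false n<k) ⟩
  1 * R k n x + n * R k n x                     ≡⟨ cong (λ r → 1 * r + n * r) (R-≤ k x n (ℕₚ.<⇒≤ n<k)) ⟩
  1 * n ! + n * n !                             ≡⟨ cong (_+ n * n !) (ℕₚ.*-identityˡ (n !)) ⟩
  suc n !                                       ∎
  where open ≡-Reasoning

rising : (k x m : ℕ) → ℕ
rising k x m = product (applyUpTo (λ i → x + (k + i)) m)

rising-suc : (k x m : ℕ) → rising k x (suc m) ≡ rising k x m * (x + (k + m))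
rising-suc k x m = begin
  product (applyUpTo f (suc m))    ≡⟨ cong product (Listₚ.applyUpTo-∷ʳ f m) ⟨
  product (applyUpTo f m ∷ʳ f m)   ≡⟨ ListActionₚ.product-++ (applyUpTo f m) (f m ∷ []) ⟩
  rising k x m * (f m * 1)         ≡⟨ cong (rising k x m *_) (ℕₚ.*-identityʳ (f m)) ⟩
  rising k x m * f m               ∎
  where
  open ≡-Reasoning
  f : ℕ → ℕ
  f i = x + (k + i)

R-≥ : (k x m : ℕ) → R k (k + m) x ≡ k ! * rising k x m
R-≥ k x zero rewrite ℕₚ.+-identityʳ k = trans (R-≤ k x k ℕₚ.≤-refl) (sym (ℕₚ.*-identityʳ (k !)))
R-≥ k x (suc m) rewrite ℕₚ.+-suc k m = begin
  R k (suc (k + m)) x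
    ≡⟨ R-suc k (k + m) x ⟩
  x ^ fromBool (k ≤ᵇ k + m) * R k (k + m) x + (k + m) * R k (k + m) x
    ≡⟨ cong (λ b → x ^ fromBool b * R k (k + m) x + (k + m) * R k (k + m) x) (≤ᵇ-true (ℕₚ.m≤m+n k m)) ⟩
  x ^ 1 * R k (k + m) x + (k + m) * R k (k + m) x
    ≡⟨ cong (λ r → x ^ 1 * r + (k + m) * r) (R-≥ k x m) ⟩
  x ^ 1 * (k ! * rising k x m) + (k + m) * (k ! * rising k x m)
    ≡⟨ solve 4 (λ X K P Q → (X :* con 1) :* (K :* P) :+ Q :* (K :* P) := K :* (P :* (X :+ Q)))
             refl x (k !) (rising k x m) (k + m) ⟩
  k ! * (rising k x m * (x + (k + m)))
    ≡⟨ cong (k ! *_) (rising-suc k x m) ⟨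
  k ! * rising k x (suc m)
    ∎
  where
  open ≡-Reasoning
  open +-*-Solver

rising-*-! : (k x m : ℕ) → rising (suc k) x m * (x + k) ! ≡ (x + k + m) !
rising-*-! k x zero = trans (ℕₚ.*-identityˡ _) (cong _! (sym (ℕₚ.+-identityʳ (x + k))))
rising-*-! k x (suc m) = begin
  rising (suc k) x (suc m) * (x + k) !
    ≡⟨ cong (_* (x + k) !) (rising-suc (suc k) x m) ⟩
  rising (suc k) x m * (x + (suc k + m)) * (x + k) !
    ≡⟨ *-Semigroupₚ.xy∙z≈y∙xz (rising (suc k) x m) (x + (suc k + m)) ((x + k) !) ⟩
  (x + (suc k + m)) * (rising (suc k) x m * (x + k) !)
    ≡⟨ cong₂ _*_ (ℕₚ.+-suc x (k + m)) (rising-*-! k x m) ⟩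
  suc (x + (k + m)) * (x + k + m) !
    ≡⟨ cong (λ a → suc a * (x + k + m) !) (ℕₚ.+-assoc x k m) ⟨
  suc (x + k + m) !
    ≡⟨ cong _! (ℕₚ.+-suc (x + k) m) ⟨
  (x + k + suc m) !
    ∎
  where
  open ≡-Reasoning

k!*nCk*[n∸k]!≡n! : ∀ {n k} → k ≤ n → k ! * (n C k) * (n ∸ k) ! ≡ n !
k!*nCk*[n∸k]!≡n! {n} {k} k≤n = begin
  k ! * (n C k) * (n ∸ k) !                   ≡⟨ *-Semigroupₚ.xy∙z≈xz∙y (k !) (n C k) ((n ∸ k) !) ⟩
  k ! * (n ∸ k) ! * (n C k)                   ≡⟨ cong (k ! * (n ∸ k) ! *_) (nCk≡n!/k![n-k]! k≤n) ⟩
  k ! * (n ∸ k) ! * (n ! / (k ! * (n ∸ k) !)) ≡⟨ m*[n/m]≡n (k![n∸k]!∣n! k≤n) ⟩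
  n !                                         ∎
  where
  open ≡-Reasoning
  instance
    _ = _!*_!≢0 k (n ∸ k)

rising≡!*C : (k x m : ℕ) → rising (suc k) x m ≡ m ! * ((x + suc k + m ∸ 1) C m)
rising≡!*C k x m = ℕₚ.*-cancelʳ-≡ _ _ ((x + k) !) {{(x + k) !≢0}} (begin
  rising (suc k) x m * (x + k) !              ≡⟨ rising-*-! k x m ⟩
  (x + k + m) !                               ≡⟨ k!*nCk*[n∸k]!≡n! (ℕₚ.m≤n+m m (x + k)) ⟨
  m ! * (N C m) * (N ∸ m) !                   ≡⟨ cong (λ a → m ! * (N C m) * a !) (ℕₚ.m+n∸n≡m (x + k) m) ⟩
  m ! * (N C m) * (x + k) !                   ≡⟨ cong (λ a → m ! * (a C m) * (x + k) !) shift ⟩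
  m ! * ((x + suc k + m ∸ 1) C m) * (x + k) ! ∎)
  where
  open ≡-Reasoning
  N = x + k + m
  shift : N ≡ x + suc k + m ∸ 1
  shift = cong (λ a → a + m ∸ 1) (sym (ℕₚ.+-suc x k))

mainTheorem6 : (k : ℕ) → 2 ≤ k →
    ((n x : ℕ) → 1 ≤ n → n ≤ k → R k n x ≡ n !)
    × ((n x : ℕ) → k < n →
        R k n x ≡ k ! * product (applyUpTo (λ i → x + (k + i)) (n ∸ k)))
    × ((m x : ℕ) →
        R k (k + m) x ≡ m ! * (k ! * ((x + k + m ∸ 1) C m)))
mainTheorem6 zero ()
mainTheorem6 k@(suc k-1) _ = small , large , binomial
  where
  small : (n x : ℕ) → 1 ≤ n → n ≤ k → R k n x ≡ n !
  small n x _ n≤k = R-≤ k x n n≤k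
  large : (n x : ℕ) → k < n → R k n x ≡ k ! * rising k x (n ∸ k)
  large n x k<n = subst (λ n′ → R k n′ x ≡ k ! * rising k x (n ∸ k))
                        (ℕₚ.m+[n∸m]≡n (ℕₚ.<⇒≤ k<n)) (R-≥ k x (n ∸ k))
  binomial : (m x : ℕ) → R k (k + m) x ≡ m ! * (k ! * ((x + k + m ∸ 1) C m))
  binomial m x = begin
    R k (k + m) x                             ≡⟨ R-≥ k x m ⟩
    k ! * rising k x m                        ≡⟨ cong (k ! *_) (rising≡!*C k-1 x m) ⟩
    k ! * (m ! * ((x + k + m ∸ 1) C m))       ≡⟨ *-Semigroupₚ.x∙yz≈y∙xz (k !) (m !) _ ⟩
    m ! * (k ! * ((x + k + m ∸ 1) C m))       ∎
    where open ≡-Reasoning
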